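{- Let $\mathcal{F}$ be a family of $r$-graphs and let $H$ be an $r$-graph with maximum $(r-1)$-degree at most $D$. Then as $D\to\infty$, $$\mathrm{ex}(H,\mathcal{F})=\Omega\left(\frac{\mathrm{ex}(D,\mathcal{H}(\mathcal{F}))}{D^r}\right)\cdot e(H).$$
   Context: An $r$-graph is an $r$-uniform hypergraph; the $(r-1)$-degree of an $(r-1)$-set is the number of edges containing it. For a family $\mathcal{G}$ of $r$-graphs, $\mathrm{ex}(n,\mathcal{G})$ is the maximum number of edges in an $n$-vertex $r$-graph containing no member of $\mathcal{G}$, and $\mathrm{ex}(H,\mathcal{G})$ is the maximum number of edges of a subgraph of $H$ containing no member of $\mathcal{G}$. For $r$-graphs $F,F'$, a map $\phi:V(F)\to V(F')$ is a local isomorphism if (a) $\phi$ is a homomorphism (it maps edges to edges) and (b) $\phi(e)\ne\phi(f)$ for all $e,f\in E(F)$ with $|e\cap f|=r-1$. $\mathcal{H}(F)$ is the set of $r$-graphs $F'$ for which there is a local isomorphism $\phi:V(F)\to V(F')$ such that $\phi$ is surjective on vertices and the induced map $E(F)\to E(F')$ is surjective; $\mathcal{H}(\mathcal{F})=\bigcup_{F\in\mathcal{F}}\mathcal{H}(F)$. -}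

module Defs where

open import Data.Nat using (ℕ; _≤_; _∸_)
open import Data.Fin using (Fin)
open import Data.Fin.Subset using (Subset; _∈_; _⊆_; _∩_; ∣_∣)
open import Data.Fin.Subset.Properties using (_⊆?_)
open import Data.List using (List; length; filter)
open import Data.List.Relation.Unary.All using (All)
open import Data.List.Relation.Unary.Unique.Propositional using (Unique)
open import Data.List.Membership.Propositional renaming (_∈_ to _∈ₗ_)
open import Data.Product using (Σ; ∃; _×_; _,_)
open import Relation.Binary.PropositionalEquality using (_≡_; _≢_)
open import Relation.Nullary using (¬_)
open import Function.Bundles using (_⇔_)
open import Function.Definitions using (Injective; Surjective)

record Graph (r n : ℕ) : Set where
  field
    edges   : List (Subset n)
    uniform : All (λ e → ∣ e ∣ ≡ r) edges
    unique  : Unique edges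
open Graph public

e : ∀ {r n} → Graph r n → ℕ
e H = length (edges H)

deg : ∀ {r n} → Graph r n → Subset n → ℕ
deg H S = length (filter (S ⊆?_) (edges H))

MaxDeg≤ : ∀ {r n} → Graph r n → ℕ → Set
MaxDeg≤ {r} {n} H D = (S : Subset n) → ∣ S ∣ ≡ r ∸ 1 → deg H S ≤ D

MapsTo : ∀ {n m} → (Fin n → Fin m) → Subset n → Subset m → Set
MapsTo φ s t = ∀ j → (j ∈ t) ⇔ (∃ λ i → i ∈ s × φ i ≡ j)

Hom : ∀ {r n m} → Graph r n → Graph r m → (Fin n → Fin m) → Set
Hom F G φ = ∀ f → f ∈ₗ edges F → ∃ λ g → g ∈ₗ edges G × MapsTo φ f g

_⊑_ : ∀ {r n m} → Graph r n → Graph r m → Set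
F ⊑ G = ∃ λ φ → Injective _≡_ _≡_ φ × Hom F G φ

Fam : ℕ → Set₁
Fam r = (n : ℕ) → Graph r n → Set

Free : ∀ {r n} → Fam r → Graph r n → Set
Free {r} 𝓖 G = (m : ℕ) (F : Graph r m) → 𝓖 m F → ¬ (F ⊑ G)

LocIso : ∀ {r n m} → Graph r n → Graph r m → (Fin n → Fin m) → Set
LocIso {r} F F' φ =
  Hom F F' φ ×
  (∀ f g f' g' → f ∈ₗ edges F → g ∈ₗ edges F → ∣ f ∩ g ∣ ≡ r ∸ 1 →
     MapsTo φ f f' → MapsTo φ g g' → f' ≢ g')

ℋ₁ : ∀ {r n} → Graph r n → Fam r
ℋ₁ F m F' = ∃ λ φ → LocIso F F' φ × Surjective _≡_ _≡_ φ ×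
  (∀ g → g ∈ₗ edges F' → ∃ λ f → f ∈ₗ edges F × MapsTo φ f g)

ℋ : ∀ {r} → Fam r → Fam r
ℋ {r} 𝓕 m F' = ∃ λ n → Σ (Graph r n) λ F → 𝓕 n F × ℋ₁ F m F'

IsEx : ∀ {r} → ℕ → Fam r → ℕ → Set
IsEx {r} n 𝓖 x =
  (Σ (Graph r n) λ G → Free 𝓖 G × e G ≡ x) ×
  ((G : Graph r n) → Free 𝓖 G → e G ≤ x)

_≤G_ : ∀ {r n} → Graph r n → Graph r n → Set
G ≤G H = ∀ f → f ∈ₗ edges G → f ∈ₗ edges H

IsExIn : ∀ {r n} → Graph r n → Fam r → ℕ → Set
IsExIn {r} {n} H 𝓖 x =
  (Σ (Graph r n) λ G → G ≤G H × Free 𝓖 G × e G ≡ x) ×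
  ((G : Graph r n) → G ≤G H → Free 𝓖 G → e G ≤ x)

-- Let G be an extremal ℋ(𝓕)-free r-graph on D vertices, placed inside [N] with N = K·D. For a map
-- φ : V(H) → [N], keep the edges of H that φ maps onto an edge of G and that clash with no edge of H
-- sharing r - 1 vertices with them (a clash: the same image). The kept edges form an 𝓕-free graph, since
-- φ maps a copy of F among them locally injectively onto a member of ℋ(F) inside G. Averaging over all
-- N^n maps, an edge is mapped onto G with weight at least e(G)/N^r, while by the (r-1)-degree bound its
-- clashes have weight at most r·D·e(G)·r^(r+1)/N^(r+1), at most half of the former once K > 2r^(r+2).
-- So some φ keeps e(G)·e(H)/(2N^r) edges, i.e. e(G)·e(H) ≤ 2K^r·ex(H,𝓕)·D^r.

module Submission where

open import Data.Nat using (ℕ; zero; suc; _+_; _*_; _∸_; _^_; _≤_; _<_; z≤n; s≤s; NonZero; _≟_; ≢-nonZero⁻¹; >-nonZero)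
open import Data.Nat.Properties
open import Data.Nat.Tactic.RingSolver using (solve-∀)
open import Algebra.Properties.CommutativeSemigroup +-commutativeSemigroup using () renaming (interchange to +-interchange)
open import Algebra.Properties.CommutativeSemigroup *-commutativeSemigroup
  using () renaming (interchange to *-interchange; x∙yz≈y∙xz to x*[y*z]≡y*[x*z])
open import Data.Bool using (Bool; true; false; if_then_else_)
open import Data.Bool.Properties using () renaming (_≟_ to _≟ᵇ_)
open import Data.Fin using (Fin; zero; suc; _↑ˡ_; splitAt)
open import Data.Fin.Properties using (any?; ↑ˡ-injective; splitAt-↑ˡ) renaming (_≟_ to _≟ᶠ_; suc-injective to Fin-suc-injective)
open import Data.Fin.Subset using (Subset; inside; outside; _∈_; _∉_; _⊆_; _∩_; _∪_; _─_; _-_; ∣_∣; ⁅_⁆; ⊥)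
open import Data.Fin.Subset.Properties
  using (_∈?_; _⊆?_; ⊆-antisym; ⊥⊆; ∉⊥; ∣⊥∣≡0; ∣⁅x⁆∣≡1; x∈⁅x⁆; x∈⁅y⁆⇒x≡y; p⊆p∪q; q⊆p∪q; x∈p∪q⁻; x∈p∪q⁺;
         p∩q⊆p; x∈p∩q⁻; ∩-idem; drop-there; p─q⊆p; p─⊥≡p; x∈p∧x≢y⇒x∈p-y; p⊂q⇒∣p∣<∣q∣)
open import Data.Vec using ([]; _∷_; here; there; lookup)
open import Data.Vec.Properties using (≡-dec; lookup⇒[]=; []=⇒lookup)
open import Data.List using (List; []; _∷_; length; map; filter; deduplicate)
open import Data.List.Relation.Unary.All as All using (All; []; _∷_)
import Data.List.Relation.Unary.All.Properties as Allₚ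
open import Data.List.Relation.Unary.Unique.Propositional using (Unique; []; _∷_)
import Data.List.Relation.Unary.Unique.Propositional.Properties as Uniqueₚ
open import Data.List.Membership.Propositional.Properties using (∈-filter⁻; ∈-map⁺; ∈-map⁻; ∈-deduplicate⁺; ∈-deduplicate⁻)
open import Data.List.Relation.Unary.Unique.DecPropositional.Properties using (deduplicate-!)
open import Data.List.Relation.Unary.Any using (here; there)
open import Data.List.Membership.Propositional using () renaming (_∈_ to _∈ₗ_)
open import Data.Vec.Functional using () renaming (_∷_ to _∷ᶠ_)
open import Data.Product using (Σ; ∃; _×_; _,_; proj₁; proj₂)
open import Data.Sum using (inj₁; inj₂; [_,_]′)
open import Relation.Binary.PropositionalEquality
open import Relation.Nullary using (Dec; yes; no; does; contradiction; ¬?; _×-dec_)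
open import Relation.Unary using (Pred; Decidable)
open import Relation.Binary.Definitions using (DecidableEquality)
open import Relation.Nullary.Decidable using (dec-true; dec-false)
open import Level using (0ℓ)
open import Function using (_∘_; id; const)
open import Function.Bundles using (mk⇔; Equivalence)
open import Function.Definitions using (Injective; Surjective)
open import Defs

private
  variable
    n m k : ℕ
    A : Set

  there-witness : ∀ {p q : Subset n} {s t} → (∃ λ x → x ∈ q × x ∉ p) → ∃ λ x → x ∈ t ∷ q × x ∉ s ∷ p
  there-witness (x , x∈q , x∉p) = suc x , there x∈q , x∉p ∘ drop-there

-- Subsets of Fin n

x∈p─q⇒x∉q : ∀ (p q : Subset n) {x} → x ∈ p ─ q → x ∉ q
x∈p─q⇒x∉q (_ ∷ p) (_ ∷ q) (there x∈p─q) (there x∈q) = x∈p─q⇒x∉q p q x∈p─q x∈q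
x∈p─q⇒x∉q (inside ∷ p) (inside ∷ q) () here
x∈p─q⇒x∉q (outside ∷ p) (inside ∷ q) () here

x∈p-y⇒x≢y : ∀ (p : Subset n) {x y} → x ∈ p - y → x ≢ y
x∈p-y⇒x≢y p {y = y} x∈p-y refl = x∈p─q⇒x∉q p ⁅ y ⁆ x∈p-y (x∈⁅x⁆ y)

suc∣p-x∣≡∣p∣ : ∀ {p : Subset n} {x} → x ∈ p → suc ∣ p - x ∣ ≡ ∣ p ∣
suc∣p-x∣≡∣p∣ {p = inside ∷ p} here = cong (suc ∘ ∣_∣) (p─⊥≡p p)
suc∣p-x∣≡∣p∣ {p = inside ∷ p} (there x∈p) = cong suc (suc∣p-x∣≡∣p∣ x∈p)
suc∣p-x∣≡∣p∣ {p = outside ∷ p} (there x∈p) = suc∣p-x∣≡∣p∣ x∈p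

∣p∪q∣≡∣p∣+∣q∣ : ∀ (p q : Subset n) → (∀ {x} → x ∈ p → x ∉ q) → ∣ p ∪ q ∣ ≡ ∣ p ∣ + ∣ q ∣
∣p∪q∣≡∣p∣+∣q∣ [] [] _ = refl
∣p∪q∣≡∣p∣+∣q∣ (inside ∷ p) (inside ∷ q) disj = contradiction here (disj here)
∣p∪q∣≡∣p∣+∣q∣ (inside ∷ p) (outside ∷ q) disj = cong suc (∣p∪q∣≡∣p∣+∣q∣ p q λ x∈p x∈q → disj (there x∈p) (there x∈q))
∣p∪q∣≡∣p∣+∣q∣ (outside ∷ p) (inside ∷ q) disj =
  trans (cong suc (∣p∪q∣≡∣p∣+∣q∣ p q λ x∈p x∈q → disj (there x∈p) (there x∈q))) (sym (+-suc _ _))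
∣p∪q∣≡∣p∣+∣q∣ (outside ∷ p) (outside ∷ q) disj = ∣p∪q∣≡∣p∣+∣q∣ p q λ x∈p x∈q → disj (there x∈p) (there x∈q)

∣p∣<∣q∣⇒∃x∈q∖p : ∀ (p q : Subset n) → ∣ p ∣ < ∣ q ∣ → ∃ λ x → x ∈ q × x ∉ p
∣p∣<∣q∣⇒∃x∈q∖p (outside ∷ p) (inside ∷ q) _ = zero , here , λ ()
∣p∣<∣q∣⇒∃x∈q∖p (inside ∷ p) (inside ∷ q) lt = there-witness (∣p∣<∣q∣⇒∃x∈q∖p p q (≤-pred lt))
∣p∣<∣q∣⇒∃x∈q∖p (inside ∷ p) (outside ∷ q) lt = there-witness (∣p∣<∣q∣⇒∃x∈q∖p p q (≤-trans (n≤1+n _) lt))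
∣p∣<∣q∣⇒∃x∈q∖p (outside ∷ p) (outside ∷ q) lt = there-witness (∣p∣<∣q∣⇒∃x∈q∖p p q lt)

p⊆q⇒∣q∣≤∣p∣⇒p≡q : ∀ {p q : Subset n} → p ⊆ q → ∣ q ∣ ≤ ∣ p ∣ → p ≡ q
p⊆q⇒∣q∣≤∣p∣⇒p≡q {p = p} {q} p⊆q ∣q∣≤∣p∣ = ⊆-antisym p⊆q q⊆p
  where
  q⊆p : q ⊆ p
  q⊆p {x} x∈q with x ∈? p
  ... | yes x∈p = x∈p
  ... | no x∉p = contradiction (p⊂q⇒∣p∣<∣q∣ (p⊆q , x , x∈q , x∉p)) (≤⇒≯ ∣q∣≤∣p∣)

∣p∣≡0⇒p≡⊥ : ∀ {p : Subset n} → ∣ p ∣ ≡ 0 → p ≡ ⊥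
∣p∣≡0⇒p≡⊥ {n} ∣p∣≡0 = sym (p⊆q⇒∣q∣≤∣p∣⇒p≡q ⊥⊆ (≤-reflexive (trans ∣p∣≡0 (sym (∣⊥∣≡0 n)))))

∣p∣≡suc⇒∃x∈p : ∀ {p : Subset n} {k} → ∣ p ∣ ≡ suc k → ∃ λ x → x ∈ p
∣p∣≡suc⇒∃x∈p {n} {p} ∣p∣≡1+k =
  let x , x∈p , _ = ∣p∣<∣q∣⇒∃x∈q∖p ⊥ p (subst₂ _<_ (sym (∣⊥∣≡0 n)) (sym ∣p∣≡1+k) (s≤s z≤n)) in x , x∈p

suc∣p∩q∣≡∣p∣⇒∃p-x⊆q : ∀ (p q : Subset n) → suc ∣ p ∩ q ∣ ≡ ∣ p ∣ → ∃ λ x → x ∈ p × p - x ⊆ q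
suc∣p∩q∣≡∣p∣⇒∃p-x⊆q p q eq with ∣p∣<∣q∣⇒∃x∈q∖p (p ∩ q) p (≤-reflexive eq)
... | x , x∈p , x∉p∩q = x , x∈p , λ y∈p-x → proj₂ (x∈p∩q⁻ p q (subst (_ ∈_) (sym p∩q≡p-x) y∈p-x))
  where
  p∩q⊆p-x : p ∩ q ⊆ p - x
  p∩q⊆p-x y∈p∩q = x∈p∧x≢y⇒x∈p-y (p∩q⊆p p q y∈p∩q) λ { refl → x∉p∩q y∈p∩q }
  p∩q≡p-x : p ∩ q ≡ p - x
  p∩q≡p-x = p⊆q⇒∣q∣≤∣p∣⇒p≡q p∩q⊆p-x (≤-reflexive (suc-injective (trans (suc∣p-x∣≡∣p∣ x∈p) (sym eq))))

∣p∣≡∣q∣∧p≢q⇒∣p∣<∣p∪q∣ : ∀ (p q : Subset n) → ∣ p ∣ ≡ ∣ q ∣ → p ≢ q → ∣ p ∣ < ∣ p ∪ q ∣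
∣p∣≡∣q∣∧p≢q⇒∣p∣<∣p∪q∣ p q ∣p∣≡∣q∣ p≢q with ∣ p ∣ <? ∣ p ∪ q ∣
... | yes lt = lt
... | no ≮ = contradiction (trans (equal-to-union p (p⊆p∪q q) ≤-refl) (sym (equal-to-union q (q⊆p∪q p q) (≤-reflexive ∣p∣≡∣q∣)))) p≢q
  where
  ∣p∪q∣≤∣p∣ : ∣ p ∪ q ∣ ≤ ∣ p ∣
  ∣p∪q∣≤∣p∣ = ≮⇒≥ ≮
  equal-to-union : ∀ s → s ⊆ p ∪ q → ∣ p ∣ ≤ ∣ s ∣ → s ≡ p ∪ q
  equal-to-union s s⊆ ∣p∣≤∣s∣ = p⊆q⇒∣q∣≤∣p∣⇒p≡q s⊆ (≤-trans ∣p∪q∣≤∣p∣ ∣p∣≤∣s∣)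

-- Images of subsets

img : (Fin n → Fin m) → Subset n → Subset m
img φ [] = ⊥
img φ (inside ∷ s) = ⁅ φ zero ⁆ ∪ img (φ ∘ suc) s
img φ (outside ∷ s) = img (φ ∘ suc) s

∈-img⁺ : ∀ (φ : Fin n → Fin m) (s : Subset n) {i} → i ∈ s → φ i ∈ img φ s
∈-img⁺ φ (inside ∷ s) here = p⊆p∪q _ (x∈⁅x⁆ (φ zero))
∈-img⁺ φ (inside ∷ s) (there i∈s) = q⊆p∪q ⁅ φ zero ⁆ _ (∈-img⁺ (φ ∘ suc) s i∈s)
∈-img⁺ φ (outside ∷ s) (there i∈s) = ∈-img⁺ (φ ∘ suc) s i∈s

∈-img⁻ : ∀ (φ : Fin n → Fin m) (s : Subset n) {j} → j ∈ img φ s → ∃ λ i → i ∈ s × φ i ≡ j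
∈-img⁻ φ [] j∈ = contradiction j∈ ∉⊥
∈-img⁻ φ (inside ∷ s) j∈ with x∈p∪q⁻ ⁅ φ zero ⁆ (img (φ ∘ suc) s) j∈
... | inj₁ j∈⁅φ0⁆ = zero , here , sym (x∈⁅y⁆⇒x≡y _ j∈⁅φ0⁆)
... | inj₂ j∈img = let i , i∈s , eq = ∈-img⁻ (φ ∘ suc) s j∈img in suc i , there i∈s , eq
∈-img⁻ φ (outside ∷ s) j∈ = let i , i∈s , eq = ∈-img⁻ (φ ∘ suc) s j∈ in suc i , there i∈s , eq

MapsTo-img : ∀ (φ : Fin n → Fin m) (s : Subset n) → MapsTo φ s (img φ s)
MapsTo-img φ s j = mk⇔ (∈-img⁻ φ s) λ { (i , i∈s , refl) → ∈-img⁺ φ s i∈s }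

img-unique : ∀ (φ : Fin n → Fin m) (s : Subset n) {t} → MapsTo φ s t → t ≡ img φ s
img-unique φ s mt = ⊆-antisym
  (λ j∈t → let i , i∈s , eq = Equivalence.to (mt _) j∈t in subst (_∈ img φ s) eq (∈-img⁺ φ s i∈s))
  (λ j∈img → Equivalence.from (mt _) (∈-img⁻ φ s j∈img))

img-cong : ∀ {φ ψ : Fin n → Fin m} (s : Subset n) → (∀ {i} → i ∈ s → φ i ≡ ψ i) → img φ s ≡ img ψ s
img-cong {φ = φ} {ψ} s φ≗ψ = img-unique ψ s λ j → mk⇔
  (λ j∈ → let i , i∈s , eq = ∈-img⁻ φ s j∈ in i , i∈s , trans (sym (φ≗ψ i∈s)) eq)
  (λ { (i , i∈s , refl) → subst (_∈ img φ s) (φ≗ψ i∈s) (∈-img⁺ φ s i∈s) })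

img-∘ : ∀ (φ : Fin m → Fin k) (ψ : Fin n → Fin m) (s : Subset n) → img (φ ∘ ψ) s ≡ img φ (img ψ s)
img-∘ φ ψ s = sym (img-unique (φ ∘ ψ) s λ j → mk⇔
  (λ j∈ → let i , i∈ , φi≡j = ∈-img⁻ φ (img ψ s) j∈
              i' , i'∈s , ψi'≡i = ∈-img⁻ ψ s i∈
          in i' , i'∈s , trans (cong φ ψi'≡i) φi≡j)
  (λ { (i , i∈s , refl) → ∈-img⁺ φ _ (∈-img⁺ ψ s i∈s) }))

img-id : ∀ (s : Subset n) → img id s ≡ s
img-id s = sym (img-unique id s λ j → mk⇔ (λ j∈s → j , j∈s , refl) λ { (i , i∈s , refl) → i∈s })

∣img∣≡∣s∣ : ∀ (φ : Fin n → Fin m) → Injective _≡_ _≡_ φ → (s : Subset n) → ∣ img φ s ∣ ≡ ∣ s ∣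
∣img∣≡∣s∣ {m = m} φ inj [] = ∣⊥∣≡0 m
∣img∣≡∣s∣ φ inj (inside ∷ s) = begin
  ∣ ⁅ φ zero ⁆ ∪ img (φ ∘ suc) s ∣       ≡⟨ ∣p∪q∣≡∣p∣+∣q∣ _ _ disjoint ⟩
  ∣ ⁅ φ zero ⁆ ∣ + ∣ img (φ ∘ suc) s ∣   ≡⟨ cong₂ _+_ (∣⁅x⁆∣≡1 (φ zero)) (∣img∣≡∣s∣ (φ ∘ suc) (Fin-suc-injective ∘ inj) s) ⟩
  suc ∣ s ∣                             ∎
  where
  open ≡-Reasoning
  disjoint : ∀ {x} → x ∈ ⁅ φ zero ⁆ → x ∉ img (φ ∘ suc) s
  disjoint x∈⁅φ0⁆ x∈img with ∈-img⁻ (φ ∘ suc) s x∈img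
  ... | i , _ , eq with inj (trans eq (x∈⁅y⁆⇒x≡y _ x∈⁅φ0⁆))
  ... | ()
∣img∣≡∣s∣ φ inj (outside ∷ s) = ∣img∣≡∣s∣ (φ ∘ suc) (Fin-suc-injective ∘ inj) s

img-injective : ∀ (φ : Fin n → Fin m) → Injective _≡_ _≡_ φ → Injective _≡_ _≡_ (img φ)
img-injective φ inj {s} {t} eq = ⊆-antisym (pull eq) (pull (sym eq))
  where
  pull : ∀ {s t} → img φ s ≡ img φ t → s ⊆ t
  pull {s} {t} eq i∈s =
    let i' , i'∈t , φi'≡φi = ∈-img⁻ φ t (subst (_ ∈_) eq (∈-img⁺ φ s i∈s)) in subst (_∈ t) (inj φi'≡φi) i'∈t

∃img≡ : ∀ {D} (e : Subset n) (g : Subset (suc D)) → ∣ e ∣ ≡ ∣ g ∣ → ∃ λ (σ : Fin n → Fin (suc D)) → img σ e ≡ g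
∃img≡ [] g ∣g∣≡0 = (λ ()) , sym (∣p∣≡0⇒p≡⊥ (sym ∣g∣≡0))
∃img≡ (outside ∷ e) g eq = let σ , img≡g = ∃img≡ e g eq in zero ∷ᶠ σ , img≡g
∃img≡ (inside ∷ e) g eq with ∣p∣≡suc⇒∃x∈p (sym eq)
... | j , j∈g with ∃img≡ e (g - j) (suc-injective (trans eq (sym (suc∣p-x∣≡∣p∣ j∈g))))
... | σ , img≡g-j = j ∷ᶠ σ , ⊆-antisym to from
  where
  to : ⁅ j ⁆ ∪ img σ e ⊆ g
  to x∈ with x∈p∪q⁻ ⁅ j ⁆ (img σ e) x∈
  ... | inj₁ x∈⁅j⁆ = subst (_∈ g) (sym (x∈⁅y⁆⇒x≡y j x∈⁅j⁆)) j∈g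
  ... | inj₂ x∈img = p─q⊆p g ⁅ j ⁆ (subst (_ ∈_) img≡g-j x∈img)
  from : g ⊆ ⁅ j ⁆ ∪ img σ e
  from {x} x∈g with x ≟ᶠ j
  ... | yes refl = x∈p∪q⁺ (inj₁ (x∈⁅x⁆ x))
  ... | no x≢j = x∈p∪q⁺ (inj₂ (subst (x ∈_) (sym img≡g-j) (x∈p∧x≢y⇒x∈p-y x∈g x≢j)))

-- Factoring a map through its image

record Factorisation (h : Fin n → Fin k) : Set where
  field
    {size} : ℕ
    χ : Fin n → Fin size
    ι : Fin size → Fin k
    χ-surjective : Surjective _≡_ _≡_ χ
    ι-injective : Injective _≡_ _≡_ ι
    ι∘χ≗h : ∀ x → ι (χ x) ≡ h x

factorise : ∀ (h : Fin n → Fin k) → Factorisation h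
factorise {zero} h = record
  { size = 0 ; χ = λ () ; ι = λ () ; χ-surjective = λ () ; ι-injective = λ { {()} } ; ι∘χ≗h = λ () }
factorise {suc n} h with factorise (h ∘ suc)
... | record { χ = χ ; ι = ι ; χ-surjective = χ-surj ; ι-injective = ι-inj ; ι∘χ≗h = comm }
  with any? (λ y → ι y ≟ᶠ h zero)
... | yes (y , ιy≡h0) = record
  { χ = y ∷ᶠ χ ; ι = ι ; ι-injective = ι-inj
  ; χ-surjective = λ z → let x , χx≡z = χ-surj z in suc x , λ { refl → χx≡z refl }
  ; ι∘χ≗h = λ { zero → ιy≡h0 ; (suc x) → comm x } }
... | no h0∉ι = record
  { χ = zero ∷ᶠ (suc ∘ χ) ; ι = h zero ∷ᶠ ι ; χ-surjective = surj ; ι-injective = inj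
  ; ι∘χ≗h = λ { zero → refl ; (suc x) → comm x } }
  where
  surj : Surjective _≡_ _≡_ (zero ∷ᶠ (suc ∘ χ))
  surj zero = zero , λ { refl → refl }
  surj (suc z) = let x , χx≡z = χ-surj z in suc x , λ { refl → cong suc (χx≡z refl) }
  inj : Injective _≡_ _≡_ (h zero ∷ᶠ ι)
  inj {zero} {zero} _ = refl
  inj {zero} {suc y} eq = contradiction (y , sym eq) h0∉ι
  inj {suc x} {zero} eq = contradiction (x , eq) h0∉ι
  inj {suc x} {suc y} eq = cong suc (ι-inj eq)

-- Finite sums

sumFin : (Fin m → ℕ) → ℕ
sumFin {zero} f = 0
sumFin {suc m} f = f zero + sumFin (f ∘ suc)

prodFin : (Fin m → ℕ) → ℕ
prodFin {zero} f = 1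
prodFin {suc m} f = f zero * prodFin (f ∘ suc)

sumMap : ((Fin n → Fin m) → ℕ) → ℕ
sumMap {zero} f = f (λ ())
sumMap {suc n} f = sumFin λ x → sumMap λ φ → f (x ∷ᶠ φ)

sumList : List A → (A → ℕ) → ℕ
sumList [] f = 0
sumList (a ∷ as) f = f a + sumList as f

sumFin-cong : ∀ {f g : Fin m → ℕ} → (∀ x → f x ≡ g x) → sumFin f ≡ sumFin g
sumFin-cong {zero} f≗g = refl
sumFin-cong {suc m} f≗g = cong₂ _+_ (f≗g zero) (sumFin-cong (f≗g ∘ suc))

sumFin-mono-≤ : ∀ {f g : Fin m → ℕ} → (∀ x → f x ≤ g x) → sumFin f ≤ sumFin g
sumFin-mono-≤ {zero} f≤g = z≤n
sumFin-mono-≤ {suc m} f≤g = +-mono-≤ (f≤g zero) (sumFin-mono-≤ (f≤g ∘ suc))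

sumFin-distrib-+ : ∀ (f g : Fin m → ℕ) → sumFin (λ x → f x + g x) ≡ sumFin f + sumFin g
sumFin-distrib-+ {zero} f g = refl
sumFin-distrib-+ {suc m} f g = trans (cong (f zero + g zero +_) (sumFin-distrib-+ (f ∘ suc) (g ∘ suc)))
                                     (+-interchange (f zero) (g zero) _ _)

sumFin-distribʳ-* : ∀ (f : Fin m → ℕ) c → sumFin (λ x → f x * c) ≡ sumFin f * c
sumFin-distribʳ-* {zero} f c = refl
sumFin-distribʳ-* {suc m} f c = trans (cong (f zero * c +_) (sumFin-distribʳ-* (f ∘ suc) c)) (sym (*-distribʳ-+ c (f zero) _))

sumFin-const : ∀ c → sumFin {m} (λ _ → c) ≡ m * c
sumFin-const {zero} c = refl
sumFin-const {suc m} c = cong (c +_) (sumFin-const {m} c)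

term≤sumFin : ∀ (f : Fin m → ℕ) x → f x ≤ sumFin f
term≤sumFin f zero = m≤m+n _ _
term≤sumFin f (suc x) = ≤-trans (term≤sumFin (f ∘ suc) x) (m≤n+m _ _)

sumFin≤size*some-term : ∀ (f : Fin (suc m) → ℕ) → ∃ λ x → sumFin f ≤ suc m * f x
sumFin≤size*some-term {zero} f = zero , ≤-reflexive (cong (f zero +_) (sym (+-identityʳ 0)))
sumFin≤size*some-term {suc m} f with sumFin≤size*some-term (f ∘ suc)
... | x , rest≤ with f zero ≤? f (suc x)
...   | yes f0≤ = suc x , +-mono-≤ f0≤ rest≤
...   | no f0≰ = zero , +-monoʳ-≤ (f zero) (≤-trans rest≤ (*-monoʳ-≤ (suc m) (<⇒≤ (≰⇒> f0≰))))

prodFin-cong : ∀ {f g : Fin m → ℕ} → (∀ x → f x ≡ g x) → prodFin f ≡ prodFin g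
prodFin-cong {zero} f≗g = refl
prodFin-cong {suc m} f≗g = cong₂ _*_ (f≗g zero) (prodFin-cong (f≗g ∘ suc))

sumMap-cong : ∀ {f g : (Fin n → Fin m) → ℕ} → (∀ φ → f φ ≡ g φ) → sumMap f ≡ sumMap g
sumMap-cong {zero} f≗g = f≗g _
sumMap-cong {suc n} f≗g = sumFin-cong λ x → sumMap-cong λ φ → f≗g (x ∷ᶠ φ)

sumMap-mono-≤ : ∀ {f g : (Fin n → Fin m) → ℕ} → (∀ φ → f φ ≤ g φ) → sumMap f ≤ sumMap g
sumMap-mono-≤ {zero} f≤g = f≤g _
sumMap-mono-≤ {suc n} f≤g = sumFin-mono-≤ λ x → sumMap-mono-≤ λ φ → f≤g (x ∷ᶠ φ)

sumMap-distrib-+ : ∀ (f g : (Fin n → Fin m) → ℕ) → sumMap (λ φ → f φ + g φ) ≡ sumMap f + sumMap g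
sumMap-distrib-+ {zero} f g = refl
sumMap-distrib-+ {suc n} f g =
  trans (sumFin-cong λ x → sumMap-distrib-+ (λ φ → f (x ∷ᶠ φ)) (λ φ → g (x ∷ᶠ φ)))
        (sumFin-distrib-+ (λ x → sumMap λ φ → f (x ∷ᶠ φ)) (λ x → sumMap λ φ → g (x ∷ᶠ φ)))

sumMap-distribʳ-* : ∀ (f : (Fin n → Fin m) → ℕ) c → sumMap (λ φ → f φ * c) ≡ sumMap f * c
sumMap-distribʳ-* {zero} f c = refl
sumMap-distribʳ-* {suc n} f c = trans (sumFin-cong λ x → sumMap-distribʳ-* (λ φ → f (x ∷ᶠ φ)) c)
                                     (sumFin-distribʳ-* (λ x → sumMap λ φ → f (x ∷ᶠ φ)) c)

sumMap-distribˡ-* : ∀ (f : (Fin n → Fin m) → ℕ) c → sumMap (λ φ → c * f φ) ≡ c * sumMap f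
sumMap-distribˡ-* f c = trans (sumMap-cong λ φ → *-comm c (f φ)) (trans (sumMap-distribʳ-* f c) (*-comm _ c))

sumMap-zero : sumMap {n} {m} (λ _ → 0) ≡ 0
sumMap-zero {zero} = refl
sumMap-zero {suc n} {m} = trans (sumFin-cong {m} λ _ → sumMap-zero {n} {m}) (trans (sumFin-const {m} 0) (*-zeroʳ m))

sumMap-sumFin : ∀ (f : Fin k → (Fin n → Fin m) → ℕ) → sumMap (λ φ → sumFin λ a → f a φ) ≡ sumFin λ a → sumMap (f a)
sumMap-sumFin {zero} {n} f = sumMap-zero {n}
sumMap-sumFin {suc k} f = trans (sumMap-distrib-+ (f zero) _) (cong (sumMap (f zero) +_) (sumMap-sumFin (f ∘ suc)))

sumMap-sumList : ∀ (as : List A) (f : A → (Fin n → Fin m) → ℕ) →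
                 sumMap (λ φ → sumList as λ a → f a φ) ≡ sumList as λ a → sumMap (f a)
sumMap-sumList {n = n} [] f = sumMap-zero {n}
sumMap-sumList (a ∷ as) f = trans (sumMap-distrib-+ (f a) _) (cong (sumMap (f a) +_) (sumMap-sumList as f))

sumMap-prodFin : ∀ (w : Fin n → Fin m → ℕ) → sumMap (λ φ → prodFin λ i → w i (φ i)) ≡ prodFin λ i → sumFin (w i)
sumMap-prodFin {zero} w = refl
sumMap-prodFin {suc n} w = begin
  sumFin (λ x → sumMap λ φ → w zero x * prodFin (λ i → w (suc i) (φ i)))  ≡⟨ sumFin-cong (λ x → sumMap-distribˡ-* (λ φ → prodFin (λ i → w (suc i) (φ i))) (w zero x)) ⟩
  sumFin (λ x → w zero x * sumMap λ φ → prodFin (λ i → w (suc i) (φ i)))  ≡⟨ sumFin-cong (λ x → cong (w zero x *_) (sumMap-prodFin (w ∘ suc))) ⟩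
  sumFin (λ x → w zero x * prodFin (λ i → sumFin (w (suc i))))          ≡⟨ sumFin-distribʳ-* (w zero) _ ⟩
  sumFin (w zero) * prodFin (λ i → sumFin (w (suc i)))                  ∎
  where open ≡-Reasoning

sumMap≤size*some-term : ∀ (f : (Fin n → Fin (suc m)) → ℕ) → ∃ λ φ → sumMap f ≤ suc m ^ n * f φ
sumMap≤size*some-term {zero} f = (λ ()) , ≤-reflexive (sym (+-identityʳ _))
sumMap≤size*some-term {suc n} {m} f with sumFin≤size*some-term (λ x → sumMap λ φ → f (x ∷ᶠ φ))
... | x , sum≤ with sumMap≤size*some-term (λ φ → f (x ∷ᶠ φ))
... | φ , sumx≤ = x ∷ᶠ φ , ≤-trans sum≤ (≤-trans (*-monoʳ-≤ (suc m) sumx≤) (≤-reflexive (sym (*-assoc (suc m) (suc m ^ n) (f (x ∷ᶠ φ))))))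

sumList-cong : ∀ (as : List A) {f g : A → ℕ} → (∀ a → f a ≡ g a) → sumList as f ≡ sumList as g
sumList-cong [] f≗g = refl
sumList-cong (a ∷ as) f≗g = cong₂ _+_ (f≗g a) (sumList-cong as f≗g)

sumList-mono-≤ : ∀ (as : List A) {f g : A → ℕ} → (∀ {a} → a ∈ₗ as → f a ≤ g a) → sumList as f ≤ sumList as g
sumList-mono-≤ [] f≤g = z≤n
sumList-mono-≤ (a ∷ as) f≤g = +-mono-≤ (f≤g (here refl)) (sumList-mono-≤ as (f≤g ∘ there))

sumList-distrib-+ : ∀ (as : List A) (f g : A → ℕ) → sumList as (λ a → f a + g a) ≡ sumList as f + sumList as g
sumList-distrib-+ [] f g = refl
sumList-distrib-+ (a ∷ as) f g = trans (cong (f a + g a +_) (sumList-distrib-+ as f g)) (+-interchange (f a) (g a) _ _)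

sumList-distribʳ-* : ∀ (as : List A) (f : A → ℕ) c → sumList as (λ a → f a * c) ≡ sumList as f * c
sumList-distribʳ-* [] f c = refl
sumList-distribʳ-* (a ∷ as) f c = trans (cong (f a * c +_) (sumList-distribʳ-* as f c)) (sym (*-distribʳ-+ c (f a) _))

sumList-const : ∀ (as : List A) c → sumList as (λ _ → c) ≡ length as * c
sumList-const [] c = refl
sumList-const (a ∷ as) c = cong (c +_) (sumList-const as c)

sumList-map : ∀ {B : Set} (g : A → B) (as : List A) (f : B → ℕ) → sumList (map g as) f ≡ sumList as (f ∘ g)
sumList-map g [] f = refl
sumList-map g (a ∷ as) f = cong (f (g a) +_) (sumList-map g as f)

term≤sumList : ∀ {as : List A} (f : A → ℕ) {a} → a ∈ₗ as → f a ≤ sumList as f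
term≤sumList f (here refl) = m≤m+n _ _
term≤sumList f (there a∈as) = ≤-trans (term≤sumList f a∈as) (m≤n+m _ _)

-- Counting with indicators

𝟙 : Bool → ℕ
𝟙 true = 1
𝟙 false = 0

sumFin-𝟙-lookup : ∀ (s : Subset m) → sumFin (𝟙 ∘ lookup s) ≡ ∣ s ∣
sumFin-𝟙-lookup [] = refl
sumFin-𝟙-lookup (inside ∷ s) = cong suc (sumFin-𝟙-lookup s)
sumFin-𝟙-lookup (outside ∷ s) = sumFin-𝟙-lookup s

sumFin-𝟙-≡ : ∀ (c : Fin m) → sumFin (λ x → 𝟙 (does (x ≟ᶠ c))) ≡ 1
sumFin-𝟙-≡ {suc m} zero = cong suc (trans (sumFin-cong {m} λ _ → refl) (trans (sumFin-const {m} 0) (*-zeroʳ m)))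
sumFin-𝟙-≡ {suc m} (suc c) = sumFin-𝟙-≡ c

prodFin-𝟙≤1 : ∀ (bs : Fin n → Bool) → prodFin (𝟙 ∘ bs) ≤ 1
prodFin-𝟙≤1 {zero} bs = ≤-refl
prodFin-𝟙≤1 {suc n} bs with bs zero
... | true = subst (_≤ 1) (sym (+-identityʳ _)) (prodFin-𝟙≤1 (bs ∘ suc))
... | false = z≤n

prodFin-𝟙>0⇒true : ∀ (bs : Fin n → Bool) → 1 ≤ prodFin (𝟙 ∘ bs) → ∀ i → bs i ≡ true
prodFin-𝟙>0⇒true {suc n} bs pos i with bs zero in eq
prodFin-𝟙>0⇒true {suc n} bs pos zero    | true = eq
prodFin-𝟙>0⇒true {suc n} bs pos (suc i) | true = prodFin-𝟙>0⇒true (bs ∘ suc) (subst (1 ≤_) (+-identityʳ _) pos) i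

prodFin-𝟙≡1 : ∀ (bs : Fin n → Bool) → (∀ i → bs i ≡ true) → prodFin (𝟙 ∘ bs) ≡ 1
prodFin-𝟙≡1 {zero} bs _ = refl
prodFin-𝟙≡1 {suc n} bs all-true rewrite all-true zero = trans (+-identityʳ _) (prodFin-𝟙≡1 (bs ∘ suc) (all-true ∘ suc))

sumList-𝟙-≡≤1 : ∀ (_≟_ : DecidableEquality A) {as} → Unique as → ∀ x → sumList as (λ a → 𝟙 (does (x ≟ a))) ≤ 1
sumList-𝟙-≡≤1 _≟_ [] x = z≤n
sumList-𝟙-≡≤1 _≟_ {a ∷ as} (a∉as ∷ unique) x with x ≟ a
... | yes refl = s≤s (≤-reflexive (no-more as a∉as))
  where
  no-more : ∀ bs → All (x ≢_) bs → sumList bs (λ b → 𝟙 (does (x ≟ b))) ≡ 0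
  no-more [] [] = refl
  no-more (b ∷ bs) (x≢b ∷ x∉bs) with x ≟ b
  ... | yes x≡b = contradiction x≡b x≢b
  ... | no _ = no-more bs x∉bs
... | no _ = sumList-𝟙-≡≤1 _≟_ unique x

length-filter≡sumList : ∀ {P : Pred A 0ℓ} (P? : Decidable P) (as : List A) →
                        length (filter P? as) ≡ sumList as (𝟙 ∘ does ∘ P?)
length-filter≡sumList P? [] = refl
length-filter≡sumList P? (a ∷ as) with does (P? a)
... | true = cong suc (length-filter≡sumList P? as)
... | false = length-filter≡sumList P? as

prodFin-if-pow : ∀ (U : Subset n) a c → prodFin (λ i → if lookup U i then c else a) * a ^ ∣ U ∣ ≡ c ^ ∣ U ∣ * a ^ n
prodFin-if-pow [] a c = refl
prodFin-if-pow {suc n} (inside ∷ U) a c = begin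
  c * P * (a * a ^ ∣ U ∣)     ≡⟨ *-interchange c P a (a ^ ∣ U ∣) ⟩
  c * a * (P * a ^ ∣ U ∣)     ≡⟨ cong (c * a *_) (prodFin-if-pow U a c) ⟩
  c * a * (c ^ ∣ U ∣ * a ^ n) ≡⟨ *-interchange c a (c ^ ∣ U ∣) (a ^ n) ⟩
  c * c ^ ∣ U ∣ * (a * a ^ n) ∎
  where
  open ≡-Reasoning
  P = prodFin (λ i → if lookup U i then c else a)
prodFin-if-pow {suc n} (outside ∷ U) a c = begin
  a * P * a ^ ∣ U ∣       ≡⟨ *-assoc a P _ ⟩
  a * (P * a ^ ∣ U ∣)     ≡⟨ cong (a *_) (prodFin-if-pow U a c) ⟩
  a * (c ^ ∣ U ∣ * a ^ n) ≡⟨ x*[y*z]≡y*[x*z] a (c ^ ∣ U ∣) (a ^ n) ⟩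
  c ^ ∣ U ∣ * (a * a ^ n) ∎
  where
  open ≡-Reasoning
  P = prodFin (λ i → if lookup U i then c else a)

allOn : (U : Subset n) → (Fin n → Fin m → Bool) → (Fin n → Fin m) → ℕ
allOn U w φ = prodFin λ i → 𝟙 (if lookup U i then w i (φ i) else true)

sumMap-allOn : ∀ (U : Subset n) (w : Fin n → Fin m → Bool) c → (∀ {i} → i ∈ U → sumFin (𝟙 ∘ w i) ≡ c) →
               sumMap (allOn U w) * m ^ ∣ U ∣ ≡ c ^ ∣ U ∣ * m ^ n
sumMap-allOn {n} {m} U w c count = begin
  sumMap (allOn U w) * m ^ ∣ U ∣                                           ≡⟨ cong (_* m ^ ∣ U ∣) (sumMap-prodFin choices) ⟩
  prodFin (λ i → sumFin (choices i)) * m ^ ∣ U ∣                            ≡⟨ cong (_* m ^ ∣ U ∣) (prodFin-cong count-choices) ⟩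
  prodFin (λ i → if lookup U i then c else m) * m ^ ∣ U ∣                   ≡⟨ prodFin-if-pow U m c ⟩
  c ^ ∣ U ∣ * m ^ n                                                        ∎
  where
  open ≡-Reasoning
  choices : Fin n → Fin m → ℕ
  choices i x = 𝟙 (if lookup U i then w i x else true)
  count-choices : ∀ i → sumFin (choices i) ≡ (if lookup U i then c else m)
  count-choices i with lookup U i in eq
  ... | true = count (lookup⇒[]= i U eq)
  ... | false = trans (sumFin-const {m} 1) (*-identityʳ m)

^-distribʳ-* : ∀ m n k → (m * n) ^ k ≡ m ^ k * n ^ k
^-distribʳ-* m n zero = refl
^-distribʳ-* m n (suc k) = trans (cong (m * n *_) (^-distribʳ-* m n k)) (*-interchange m n (m ^ k) (n ^ k))

x≤y+z⇒2z≤x⇒x≤2y : ∀ {x y z} → x ≤ y + z → 2 * z ≤ x → x ≤ 2 * y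
x≤y+z⇒2z≤x⇒x≤2y {x} {y} {z} x≤y+z 2z≤x = +-cancelʳ-≤ x x (2 * y) (begin
  x + x              ≡⟨ x+x≡2x x ⟩
  2 * x              ≤⟨ *-monoʳ-≤ 2 x≤y+z ⟩
  2 * (y + z)        ≡⟨ *-distribˡ-+ 2 y z ⟩
  2 * y + 2 * z      ≤⟨ +-monoʳ-≤ (2 * y) 2z≤x ⟩
  2 * y + x          ∎)
  where
  open ≤-Reasoning
  x+x≡2x : ∀ x → x + x ≡ 2 * x
  x+x≡2x = solve-∀

_≟ˢ_ : DecidableEquality (Subset n)
_≟ˢ_ = ≡-dec _≟ᵇ_

𝟙≤1 : ∀ b → 𝟙 b ≤ 1
𝟙≤1 true = ≤-refl
𝟙≤1 false = z≤n

m≤1⇒m≤𝟙 : ∀ {m} b → m ≤ 1 → (1 ≤ m → b ≡ true) → m ≤ 𝟙 b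
m≤1⇒m≤𝟙 {zero} b _ _ = z≤n
m≤1⇒m≤𝟙 {suc zero} b _ pos⇒true rewrite pos⇒true ≤-refl = ≤-refl
m≤1⇒m≤𝟙 {suc (suc m)} b (s≤s ()) _

allOn-≡≤𝟙-img≡ : ∀ (τ φ : Fin n → Fin m) (e : Subset n) →
                 allOn e (λ i x → does (x ≟ᶠ τ i)) φ ≤ 𝟙 (does (img φ e ≟ˢ img τ e))
allOn-≡≤𝟙-img≡ τ φ e = m≤1⇒m≤𝟙 _ (prodFin-𝟙≤1 matches) λ pos →
  dec-true (img φ e ≟ˢ img τ e) (img-cong e (agrees pos))
  where
  matches : Fin _ → Bool
  matches i = if lookup e i then does (φ i ≟ᶠ τ i) else true
  agrees : 1 ≤ allOn e (λ i x → does (x ≟ᶠ τ i)) φ → ∀ {i} → i ∈ e → φ i ≡ τ i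
  agrees pos {i} i∈e with prodFin-𝟙>0⇒true matches pos i
  ... | holds rewrite []=⇒lookup i∈e with φ i ≟ᶠ τ i
  ... | yes φi≡τi = φi≡τi
  ... | no _ = contradiction holds λ ()

img-p-x⊆img-q : ∀ (ψ : Fin n → Fin m) → Injective _≡_ _≡_ ψ → ∀ {p q : Subset n} {x} →
                p - x ⊆ q → img ψ p - ψ x ⊆ img ψ q
img-p-x⊆img-q ψ inj {p} {q} {x} p-x⊆q y∈ with ∈-img⁻ ψ p (p─q⊆p _ _ y∈)
... | i , i∈p , refl = ∈-img⁺ ψ q (p-x⊆q (x∈p∧x≢y⇒x∈p-y i∈p λ { refl → x∈p-y⇒x≢y (img ψ p) y∈ refl }))

x*Nᵘ≡cᵘ*y⇒x*Nˢ≤cˢ*y : ∀ {x y c s u} N .{{_ : NonZero N}} → x * N ^ u ≡ c ^ u * y → s ≤ u → c ≤ N →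
                      x * N ^ s ≤ c ^ s * y
x*Nᵘ≡cᵘ*y⇒x*Nˢ≤cˢ*y {x} {y} {c} {s} {u} N eq s≤u c≤N = *-cancelʳ-≤ _ _ (N ^ t) {{m^n≢0 N t}} (begin
  x * N ^ s * N ^ t    ≡⟨ *-assoc x _ _ ⟩
  x * (N ^ s * N ^ t)  ≡⟨ cong (x *_) (sym (^-distribˡ-+-* N s t)) ⟩
  x * N ^ (s + t)      ≡⟨ cong (λ z → x * N ^ z) s+t≡u ⟩
  x * N ^ u            ≡⟨ eq ⟩
  c ^ u * y            ≡⟨ cong (λ z → c ^ z * y) (sym s+t≡u) ⟩
  c ^ (s + t) * y      ≡⟨ cong (_* y) (^-distribˡ-+-* c s t) ⟩
  c ^ s * c ^ t * y    ≤⟨ *-monoˡ-≤ y (*-monoʳ-≤ (c ^ s) (^-monoˡ-≤ t c≤N)) ⟩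
  c ^ s * N ^ t * y    ≡⟨ swap (c ^ s) (N ^ t) y ⟩
  c ^ s * y * N ^ t    ∎)
  where
  open ≤-Reasoning
  t = u ∸ s
  s+t≡u : s + t ≡ u
  s+t≡u = m+[n∸m]≡n s≤u
  swap : ∀ a b c → a * b * c ≡ a * c * b
  swap = solve-∀

-- Maps of H into a blow-up of G

module Blowup {r n D' M : ℕ} (H : Graph r n) (G : Graph r (suc D')) where

  D N : ℕ
  D = suc D'
  N = D + M

  lift : Fin D → Fin N
  lift x = x ↑ˡ M

  lift-injective : Injective _≡_ _≡_ lift
  lift-injective = ↑ˡ-injective M _ _

  -- Points outside the copy of G go to zero; any point would do.
  retract : Fin N → Fin D
  retract j = [ id , const zero ]′ (splitAt D j)

  retract∘lift : ∀ x → retract (lift x) ≡ x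
  retract∘lift x rewrite splitAt-↑ˡ D x M = refl

  open import Data.List.Membership.DecPropositional (_≟ˢ_ {N}) using () renaming (_∈?_ to _∈ₗ?_)

  liftedG : List (Subset N)
  liftedG = map (img lift) (edges G)

  Good : (Fin n → Fin N) → Subset n → Set
  Good φ e = img φ e ∈ₗ liftedG

  good? : ∀ φ e → Dec (Good φ e)
  good? φ e = img φ e ∈ₗ? liftedG

  Clash : (Fin n → Fin N) → Subset n → Subset n → Set
  Clash φ e e' = e' ≢ e × img φ e ≡ img φ e' × Good φ e

  clash? : ∀ φ e e' → Dec (Clash φ e e')
  clash? φ e e' = ¬? (e' ≟ˢ e) ×-dec img φ e ≟ˢ img φ e' ×-dec good? φ e

  -- For good e, zero exactly when φ is locally injective at e.
  clashes : (Fin n → Fin N) → Subset n → ℕ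
  clashes φ e = sumFin λ v → 𝟙 (lookup e v) * sumList (edges H) λ e' → 𝟙 (does (e - v ⊆? e')) * 𝟙 (does (clash? φ e e'))

  Kept : (Fin n → Fin N) → Subset n → Set
  Kept φ e = Good φ e × clashes φ e ≡ 0

  kept? : ∀ φ e → Dec (Kept φ e)
  kept? φ e = good? φ e ×-dec clashes φ e ≟ 0

  keptSubgraph : (Fin n → Fin N) → Graph r n
  keptSubgraph φ = record
    { edges = filter (kept? φ) (edges H)
    ; uniform = Allₚ.filter⁺ (kept? φ) (uniform H)
    ; unique = Uniqueₚ.filter⁺ (kept? φ) (unique H)
    }

  keptSubgraph≤H : ∀ φ → keptSubgraph φ ≤G H
  keptSubgraph≤H φ f f∈ = proj₁ (∈-filter⁻ (kept? φ) f∈)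

  good≤kept+clashes : ∀ φ e → 𝟙 (does (good? φ e)) ≤ 𝟙 (does (kept? φ e)) + clashes φ e
  good≤kept+clashes φ e = by-cases (good? φ e) (kept? φ e)
    where
    by-cases : (g : Dec (Good φ e)) (k : Dec (Kept φ e)) → 𝟙 (does g) ≤ 𝟙 (does k) + clashes φ e
    by-cases g (yes _) = ≤-trans (𝟙≤1 (does g)) (m≤m+n 1 _)
    by-cases (no _) (no _) = z≤n
    by-cases (yes good) (no ¬kept) = n≢0⇒n>0 λ no-clashes → ¬kept (good , no-clashes)

  clash⇒clashes≢0 : ∀ {φ e e' v} → e' ∈ₗ edges H → v ∈ e → e - v ⊆ e' → Clash φ e e' → clashes φ e ≢ 0
  clash⇒clashes≢0 {φ} {e} {e'} {v} e'∈H v∈e e-v⊆e' clash = ≢-nonZero⁻¹ _ {{>-nonZero (begin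
    1                                                     ≡⟨ cong₂ (λ a b → 𝟙 a * 𝟙 b) (sym (dec-true (e - v ⊆? e') e-v⊆e'))
                                                                                       (sym (dec-true (clash? φ e e') clash)) ⟩
    𝟙 (does (e - v ⊆? e')) * 𝟙 (does (clash? φ e e'))   ≤⟨ term≤sumList (λ e' → 𝟙 (does (e - v ⊆? e')) * 𝟙 (does (clash? φ e e'))) e'∈H ⟩
    through v                                             ≡⟨ sym (*-identityˡ _) ⟩
    1 * through v                                         ≡⟨ cong (λ b → 𝟙 b * through v) (sym ([]=⇒lookup v∈e)) ⟩
    𝟙 (lookup e v) * through v                            ≤⟨ term≤sumFin (λ v → 𝟙 (lookup e v) * through v) v ⟩
    clashes φ e                                           ∎)}}
    where
    open ≤-Reasoning
    through : Fin n → ℕ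
    through v = sumList (edges H) λ e' → 𝟙 (does (e - v ⊆? e')) * 𝟙 (does (clash? φ e e'))

  kept⇒no-clash : ∀ {φ e e' v} → Kept φ e → e' ∈ₗ edges H → v ∈ e → e - v ⊆ e' → e' ≢ e → img φ e ≢ img φ e'
  kept⇒no-clash (good , no-clashes) e'∈H v∈e e-v⊆e' e'≢e same-image =
    clash⇒clashes≢0 e'∈H v∈e e-v⊆e' (e'≢e , same-image , good) no-clashes

  liftedG-unique : Unique liftedG
  liftedG-unique = Uniqueₚ.map⁺ (img-injective lift lift-injective) (unique G)

  onto-count≤good : ∀ φ e → sumList (edges G) (λ g → 𝟙 (does (img φ e ≟ˢ img lift g))) ≤ 𝟙 (does (good? φ e))
  onto-count≤good φ e with good? φ e
  ... | yes _ = subst (_≤ 1) (sumList-map (img lift) (edges G) _) (sumList-𝟙-≡≤1 _≟ˢ_ liftedG-unique (img φ e))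
  ... | no ¬good = ≤-trans (sumList-mono-≤ (edges G) not-onto) (≤-reflexive (trans (sumList-const (edges G) 0) (*-zeroʳ (length (edges G)))))
    where
    not-onto : ∀ {g} → g ∈ₗ edges G → 𝟙 (does (img φ e ≟ˢ img lift g)) ≤ 0
    not-onto g∈G = ≤-reflexive (cong 𝟙 (dec-false (img φ e ≟ˢ _) λ eq → ¬good (subst (_∈ₗ liftedG) (sym eq) (∈-map⁺ (img lift) g∈G))))

  -- For a fixed edge e and g ∈ G, the maps agreeing on e with a bijection e → g already have density N ^ -r.
  good-count : ∀ {e} → ∣ e ∣ ≡ r → length (edges G) * N ^ n ≤ sumMap (λ φ → 𝟙 (does (good? φ e))) * N ^ r
  good-count {e} ∣e∣≡r = begin
    length (edges G) * N ^ n                                 ≡⟨ sym (sumList-const (edges G) _) ⟩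
    sumList (edges G) (λ _ → N ^ n)                           ≤⟨ sumList-mono-≤ (edges G) onto-g-count ⟩
    sumList (edges G) (λ g → sumMap (onto g) * N ^ r)         ≡⟨ sumList-distribʳ-* (edges G) (sumMap ∘ onto) (N ^ r) ⟩
    sumList (edges G) (λ g → sumMap (onto g)) * N ^ r         ≡⟨ cong (_* N ^ r) (sym (sumMap-sumList (edges G) onto)) ⟩
    sumMap (λ φ → sumList (edges G) λ g → onto g φ) * N ^ r   ≤⟨ *-monoˡ-≤ (N ^ r) (sumMap-mono-≤ λ φ → onto-count≤good φ e) ⟩
    sumMap (λ φ → 𝟙 (does (good? φ e))) * N ^ r               ∎
    where
    open ≤-Reasoning
    onto : Subset D → (Fin n → Fin N) → ℕ
    onto g φ = 𝟙 (does (img φ e ≟ˢ img lift g))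
    onto-g-count : ∀ {g} → g ∈ₗ edges G → N ^ n ≤ sumMap (onto g) * N ^ r
    onto-g-count {g} g∈G with ∃img≡ e g (trans ∣e∣≡r (sym (All.lookup (uniform G) g∈G)))
    ... | σ , img-σ≡g = begin
      N ^ n                                                   ≡⟨ exact ⟩
      sumMap (allOn e agree) * N ^ r                          ≤⟨ *-monoˡ-≤ (N ^ r) (sumMap-mono-≤ λ φ → allOn-≡≤𝟙-img≡ τ φ e) ⟩
      sumMap (λ φ → 𝟙 (does (img φ e ≟ˢ img τ e))) * N ^ r    ≡⟨ cong (λ t → sumMap (λ φ → 𝟙 (does (img φ e ≟ˢ t))) * N ^ r) img-τ≡ ⟩
      sumMap (onto g) * N ^ r                                 ∎
      where
      τ : Fin n → Fin N
      τ = lift ∘ σ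
      agree : Fin n → Fin N → Bool
      agree i x = does (x ≟ᶠ τ i)
      img-τ≡ : img τ e ≡ img lift g
      img-τ≡ = trans (img-∘ lift σ e) (cong (img lift) img-σ≡g)
      exact : N ^ n ≡ sumMap (allOn e agree) * N ^ r
      exact = sym (begin-equality
        sumMap (allOn e agree) * N ^ r        ≡⟨ cong (λ t → sumMap (allOn e agree) * N ^ t) (sym ∣e∣≡r) ⟩
        sumMap (allOn e agree) * N ^ ∣ e ∣    ≡⟨ sumMap-allOn e agree 1 (λ {i} _ → sumFin-𝟙-≡ (τ i)) ⟩
        1 ^ ∣ e ∣ * N ^ n                      ≡⟨ cong (_* N ^ n) (^-zeroˡ ∣ e ∣) ⟩
        1 * N ^ n                              ≡⟨ *-identityˡ (N ^ n) ⟩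
        N ^ n                                  ∎)

  clash≤covered : ∀ φ e e' → 𝟙 (does (clash? φ e e')) ≤ sumList (edges G) (λ g → allOn (e ∪ e') (λ _ → lookup (img lift g)) φ)
  clash≤covered φ e e' = by-cases (clash? φ e e')
    where
    by-cases : (c : Dec (Clash φ e e')) → 𝟙 (does c) ≤ sumList (edges G) (λ g → allOn (e ∪ e') (λ _ → lookup (img lift g)) φ)
    by-cases (no _) = z≤n
    by-cases (yes (_ , same-image , good)) with ∈-map⁻ (img lift) good
    ... | g , g∈G , φ[e]≡g = ≤-trans (≤-reflexive (sym (prodFin-𝟙≡1 _ inside-g))) (term≤sumList _ g∈G)
      where
      φ[e∪e']⊆g : ∀ {i} → i ∈ e ∪ e' → φ i ∈ img lift g
      φ[e∪e']⊆g i∈ with x∈p∪q⁻ e e' i∈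
      ... | inj₁ i∈e = subst (_ ∈_) φ[e]≡g (∈-img⁺ φ e i∈e)
      ... | inj₂ i∈e' = subst (_ ∈_) (trans (sym same-image) φ[e]≡g) (∈-img⁺ φ e' i∈e')
      inside-g : ∀ i → (if lookup (e ∪ e') i then lookup (img lift g) (φ i) else true) ≡ true
      inside-g i with lookup (e ∪ e') i in eq
      ... | true = []=⇒lookup (φ[e∪e']⊆g (lookup⇒[]= i (e ∪ e') eq))
      ... | false = refl

  -- Two distinct edges cover at least r + 1 vertices, each landing in a given r-set with probability ≤ r / N.
  clash-count : ∀ {e e'} → ∣ e ∣ ≡ r → ∣ e' ∣ ≡ r → r ≤ N →
                sumMap (λ φ → 𝟙 (does (clash? φ e e'))) * N ^ suc r ≤ length (edges G) * (r ^ suc r * N ^ n)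
  clash-count {e} {e'} ∣e∣≡r ∣e'∣≡r r≤N = by-cases (e' ≟ˢ e)
    where
    open ≤-Reasoning
    covered : Subset D → (Fin n → Fin N) → ℕ
    covered g = allOn (e ∪ e') (λ _ → lookup (img lift g))
    covered-count : r < ∣ e ∪ e' ∣ → ∀ {g} → g ∈ₗ edges G → sumMap (covered g) * N ^ suc r ≤ r ^ suc r * N ^ n
    covered-count r<∣e∪e'∣ {g} g∈G = x*Nᵘ≡cᵘ*y⇒x*Nˢ≤cˢ*y {x = sumMap (covered g)} N (sumMap-allOn (e ∪ e') (λ _ → lookup (img lift g)) r ∣g∣≡r) r<∣e∪e'∣ r≤N
      where
      ∣g∣≡r : ∀ {i} → i ∈ e ∪ e' → sumFin (𝟙 ∘ lookup (img lift g)) ≡ r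
      ∣g∣≡r _ = trans (sumFin-𝟙-lookup (img lift g)) (trans (∣img∣≡∣s∣ lift lift-injective g) (All.lookup (uniform G) g∈G))
    by-cases : Dec (e' ≡ e) → sumMap (λ φ → 𝟙 (does (clash? φ e e'))) * N ^ suc r ≤ length (edges G) * (r ^ suc r * N ^ n)
    by-cases (yes e'≡e) = ≤-trans (≤-reflexive (cong (_* N ^ suc r) (trans (sumMap-cong no-self-clash) (sumMap-zero {n} {N})))) z≤n
      where
      no-self-clash : ∀ φ → 𝟙 (does (clash? φ e e')) ≡ 0
      no-self-clash φ = cong 𝟙 (dec-false (clash? φ e e') λ clash → proj₁ clash e'≡e)
    by-cases (no e'≢e) = begin
      sumMap (λ φ → 𝟙 (does (clash? φ e e'))) * N ^ suc r               ≤⟨ *-monoˡ-≤ (N ^ suc r) (sumMap-mono-≤ λ φ → clash≤covered φ e e') ⟩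
      sumMap (λ φ → sumList (edges G) λ g → covered g φ) * N ^ suc r    ≡⟨ cong (_* N ^ suc r) (sumMap-sumList (edges G) covered) ⟩
      sumList (edges G) (λ g → sumMap (covered g)) * N ^ suc r          ≡⟨ sym (sumList-distribʳ-* (edges G) (sumMap ∘ covered) (N ^ suc r)) ⟩
      sumList (edges G) (λ g → sumMap (covered g) * N ^ suc r)          ≤⟨ sumList-mono-≤ (edges G) (covered-count r<∣e∪e'∣) ⟩
      sumList (edges G) (λ _ → r ^ suc r * N ^ n)                        ≡⟨ sumList-const (edges G) _ ⟩
      length (edges G) * (r ^ suc r * N ^ n)                             ∎
      where
      r<∣e∪e'∣ : r < ∣ e ∪ e' ∣
      r<∣e∪e'∣ = subst (_< ∣ e ∪ e' ∣) ∣e∣≡r (∣p∣≡∣q∣∧p≢q⇒∣p∣<∣p∪q∣ e e' (trans ∣e∣≡r (sym ∣e'∣≡r)) (e'≢e ∘ sym))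

  clashes-count : ∀ {e} → ∣ e ∣ ≡ r → MaxDeg≤ H D → r ≤ N →
                  sumMap (λ φ → clashes φ e) * N ^ suc r ≤ r * (D * (length (edges G) * (r ^ suc r * N ^ n)))
  clashes-count {e} ∣e∣≡r max-deg r≤N = begin
    sumMap (λ φ → clashes φ e) * N ^ suc r                     ≡⟨ cong (_* N ^ suc r) expand ⟩
    sumFin (λ v → 𝟙 (lookup e v) * through v) * N ^ suc r      ≡⟨ sym (sumFin-distribʳ-* (λ v → 𝟙 (lookup e v) * through v) (N ^ suc r)) ⟩
    sumFin (λ v → 𝟙 (lookup e v) * through v * N ^ suc r)      ≤⟨ sumFin-mono-≤ per-vertex ⟩
    sumFin (λ v → 𝟙 (lookup e v) * (D * Q))                    ≡⟨ sumFin-distribʳ-* (𝟙 ∘ lookup e) (D * Q) ⟩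
    sumFin (𝟙 ∘ lookup e) * (D * Q)                            ≡⟨ cong (_* (D * Q)) (trans (sumFin-𝟙-lookup e) ∣e∣≡r) ⟩
    r * (D * Q)                                                ∎
    where
    open ≤-Reasoning
    Q : ℕ
    Q = length (edges G) * (r ^ suc r * N ^ n)
    clash-with : Subset n → (Fin n → Fin N) → ℕ
    clash-with e' φ = 𝟙 (does (clash? φ e e'))
    near : Fin n → Subset n → ℕ
    near v e' = 𝟙 (does (e - v ⊆? e'))
    through : Fin n → ℕ
    through v = sumList (edges H) λ e' → near v e' * sumMap (clash-with e')
    expand : sumMap (λ φ → clashes φ e) ≡ sumFin (λ v → 𝟙 (lookup e v) * through v)
    expand = trans (sumMap-sumFin (λ v φ → 𝟙 (lookup e v) * sumList (edges H) λ e' → near v e' * clash-with e' φ))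
                   (sumFin-cong λ v → trans (sumMap-distribˡ-* (λ φ → sumList (edges H) λ e' → near v e' * clash-with e' φ) (𝟙 (lookup e v)))
                                            (cong (𝟙 (lookup e v) *_) (trans (sumMap-sumList (edges H) λ e' φ → near v e' * clash-with e' φ)
                                                                              (sumList-cong (edges H) λ e' → sumMap-distribˡ-* (clash-with e') (near v e')))))
    through-count : ∀ {v} → v ∈ e → through v * N ^ suc r ≤ D * Q
    through-count {v} v∈e = begin
      through v * N ^ suc r                                              ≡⟨ sym (sumList-distribʳ-* (edges H) _ (N ^ suc r)) ⟩
      sumList (edges H) (λ e' → near v e' * sumMap (clash-with e') * N ^ suc r)  ≤⟨ sumList-mono-≤ (edges H) per-edge ⟩
      sumList (edges H) (λ e' → near v e' * Q)                           ≡⟨ sumList-distribʳ-* (edges H) (near v) Q ⟩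
      sumList (edges H) (near v) * Q                                     ≡⟨ cong (_* Q) (sym (length-filter≡sumList (e - v ⊆?_) (edges H))) ⟩
      deg H (e - v) * Q                                                  ≤⟨ *-monoˡ-≤ Q (max-deg (e - v) ∣e-v∣≡r∸1) ⟩
      D * Q                                                              ∎
      where
      ∣e-v∣≡r∸1 : ∣ e - v ∣ ≡ r ∸ 1
      ∣e-v∣≡r∸1 = cong (_∸ 1) (trans (suc∣p-x∣≡∣p∣ v∈e) ∣e∣≡r)
      per-edge : ∀ {e'} → e' ∈ₗ edges H → near v e' * sumMap (clash-with e') * N ^ suc r ≤ near v e' * Q
      per-edge {e'} e'∈H = ≤-trans (≤-reflexive (*-assoc (near v e') _ _))
                                   (*-monoʳ-≤ (near v e') (clash-count {e} {e'} ∣e∣≡r (All.lookup (uniform H) e'∈H) r≤N))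
    per-vertex : ∀ v → 𝟙 (lookup e v) * through v * N ^ suc r ≤ 𝟙 (lookup e v) * (D * Q)
    per-vertex v with lookup e v in eq
    ... | false = z≤n
    ... | true = begin
      1 * through v * N ^ suc r  ≡⟨ cong (_* N ^ suc r) (*-identityˡ (through v)) ⟩
      through v * N ^ suc r      ≤⟨ through-count (lookup⇒[]= v e eq) ⟩
      D * Q                      ≡⟨ sym (*-identityˡ (D * Q)) ⟩
      1 * (D * Q)                ∎

  -- A copy of F in the kept subgraph is mapped by retract ∘ φ onto a locally injective image F' ⊆ G.
  keptSubgraph-free : ∀ {𝓕 : Fam r} → 1 ≤ r → Free (ℋ 𝓕) G → ∀ φ → Free 𝓕 (keptSubgraph φ)
  keptSubgraph-free {𝓕} 1≤r G-free φ p F F∈𝓕 (ψ , ψ-injective , ψ-hom) =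
    G-free size F' (p , F , F∈𝓕 , χ , (χ-hom , χ-local) , χ-surjective , χ-onto-edges) (ι , ι-injective , ι-hom)
    where
    open Factorisation (factorise (retract ∘ φ ∘ ψ))

    kept-image : ∀ {f} → f ∈ₗ edges F → img ψ f ∈ₗ edges H × Kept φ (img ψ f)
    kept-image {f} f∈F with ψ-hom f f∈F
    ... | h , h∈kept , ψ[f]↦h with img-unique ψ f ψ[f]↦h
    ... | refl = ∈-filter⁻ (kept? φ) h∈kept

    lands-on : ∀ {f} → f ∈ₗ edges F → ∃ λ g → g ∈ₗ edges G × img φ (img ψ f) ≡ img lift g
    lands-on f∈F = ∈-map⁻ (img lift) (proj₁ (proj₂ (kept-image f∈F)))

    ι∘χ-lands-on : ∀ f {g} → img φ (img ψ f) ≡ img lift g → img ι (img χ f) ≡ g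
    ι∘χ-lands-on f {g} φψ[f]≡ = begin
      img ι (img χ f)                   ≡⟨ sym (img-∘ ι χ f) ⟩
      img (ι ∘ χ) f                     ≡⟨ img-cong f (λ {i} _ → ι∘χ≗h i) ⟩
      img (retract ∘ φ ∘ ψ) f           ≡⟨ img-∘ retract (φ ∘ ψ) f ⟩
      img retract (img (φ ∘ ψ) f)       ≡⟨ cong (img retract) (trans (img-∘ φ ψ f) φψ[f]≡) ⟩
      img retract (img lift g)          ≡⟨ sym (img-∘ retract lift g) ⟩
      img (retract ∘ lift) g            ≡⟨ img-cong g (λ {x} _ → retract∘lift x) ⟩
      img id g                          ≡⟨ img-id g ⟩
      g                                 ∎
      where open ≡-Reasoning

    edges-F' : List (Subset size)
    edges-F' = deduplicate _≟ˢ_ (map (img χ) (edges F))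

    from-F : ∀ {f'} → f' ∈ₗ edges-F' → ∃ λ f → f ∈ₗ edges F × f' ≡ img χ f
    from-F f'∈ = ∈-map⁻ (img χ) (∈-deduplicate⁻ _≟ˢ_ (map (img χ) (edges F)) f'∈)

    ∣χ[f]∣≡r : ∀ {f} → f ∈ₗ edges F → ∣ img χ f ∣ ≡ r
    ∣χ[f]∣≡r {f} f∈F with lands-on f∈F
    ... | g , g∈G , φψ[f]≡ = trans (sym (∣img∣≡∣s∣ ι ι-injective (img χ f)))
                                   (trans (cong ∣_∣ (ι∘χ-lands-on f {g} φψ[f]≡)) (All.lookup (uniform G) g∈G))

    F' : Graph r size
    F' = record
      { edges = edges-F'
      ; uniform = All.tabulate λ f'∈ → let f , f∈F , f'≡χ[f] = from-F f'∈ in trans (cong ∣_∣ f'≡χ[f]) (∣χ[f]∣≡r f∈F)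
      ; unique = deduplicate-! _≟ˢ_ _
      }

    χ-hom : Hom F F' χ
    χ-hom f f∈F = img χ f , ∈-deduplicate⁺ _≟ˢ_ (∈-map⁺ (img χ) f∈F) , MapsTo-img χ f

    χ-onto-edges : ∀ f' → f' ∈ₗ edges F' → ∃ λ f → f ∈ₗ edges F × MapsTo χ f f'
    χ-onto-edges f' f'∈ with from-F f'∈
    ... | f , f∈F , refl = f , f∈F , MapsTo-img χ f

    ι-hom : Hom F' G ι
    ι-hom f' f'∈ with from-F f'∈
    ... | f , f∈F , refl with lands-on f∈F
    ... | g , g∈G , φψ[f]≡ = g , g∈G , subst (MapsTo ι (img χ f)) (ι∘χ-lands-on f {g} φψ[f]≡) (MapsTo-img ι (img χ f))

    χ-local : ∀ f g f' g' → f ∈ₗ edges F → g ∈ₗ edges F → ∣ f ∩ g ∣ ≡ r ∸ 1 →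
              MapsTo χ f f' → MapsTo χ g g' → f' ≢ g'
    χ-local f g f' g' f∈F g∈F ∣f∩g∣≡ χ[f]↦f' χ[g]↦g' f'≡g' =
      kept⇒no-clash (proj₂ (kept-image f∈F)) (proj₁ (kept-image g∈F)) (∈-img⁺ ψ f u∈f)
                    (img-p-x⊆img-q ψ ψ-injective f-u⊆g) ψ[g]≢ψ[f] same-image
      where
      suc∣f∩g∣≡∣f∣ : suc ∣ f ∩ g ∣ ≡ ∣ f ∣
      suc∣f∩g∣≡∣f∣ = trans (cong suc ∣f∩g∣≡) (trans (m+[n∸m]≡n 1≤r) (sym (All.lookup (uniform F) f∈F)))
      g≢f : g ≢ f
      g≢f refl = 1+n≢n (trans (cong (suc ∘ ∣_∣) (sym (∩-idem f))) suc∣f∩g∣≡∣f∣)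
      ψ[g]≢ψ[f] : img ψ g ≢ img ψ f
      ψ[g]≢ψ[f] = g≢f ∘ img-injective ψ ψ-injective
      u∈f = proj₁ (proj₂ (suc∣p∩q∣≡∣p∣⇒∃p-x⊆q f g suc∣f∩g∣≡∣f∣))
      f-u⊆g = proj₂ (proj₂ (suc∣p∩q∣≡∣p∣⇒∃p-x⊆q f g suc∣f∩g∣≡∣f∣))
      same-image : img φ (img ψ f) ≡ img φ (img ψ g)
      same-image with lands-on f∈F | lands-on g∈F
      ... | g₁ , _ , φψ[f]≡ | g₂ , _ , φψ[g]≡ =
        trans φψ[f]≡ (trans (cong (img lift) g₁≡g₂) (sym φψ[g]≡))
        where
        g₁≡g₂ : g₁ ≡ g₂
        g₁≡g₂ = trans (sym (ι∘χ-lands-on f {g₁} φψ[f]≡))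
                      (trans (cong (img ι) (trans (sym (img-unique χ f χ[f]↦f')) (trans f'≡g' (img-unique χ g χ[g]↦g'))))
                             (ι∘χ-lands-on g {g₂} φψ[g]≡))

  edge-bound : ∀ {𝓕 : Fam r} {a} → 1 ≤ r → Free (ℋ 𝓕) G → MaxDeg≤ H D → r ≤ N → 2 * (r * (D * r ^ suc r)) ≤ N →
               IsExIn H 𝓕 a → length (edges G) * e H ≤ 2 * a * N ^ r
  edge-bound {𝓕} {a} 1≤r G-free max-deg r≤N 2rDrʳ⁺¹≤N (_ , maximal) = *-cancelʳ-≤ _ _ (N ^ n) {{m^n≢0 N n}} (begin
    b * E * N ^ n              ≡⟨ reorder b E (N ^ n) ⟩
    E * (b * N ^ n)            ≤⟨ Σgood-bound ⟩
    Σgood * N ^ r               ≤⟨ *-monoˡ-≤ (N ^ r) (x≤y+z⇒2z≤x⇒x≤2y {y = Σkept} {z = Σclashes} Σgood≤Σkept+Σclashes 2Σclashes≤Σgood) ⟩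
    2 * Σkept * N ^ r           ≤⟨ *-monoˡ-≤ (N ^ r) (*-monoʳ-≤ 2 Σkept-bound) ⟩
    2 * (N ^ n * a) * N ^ r    ≡⟨ reorder′ (N ^ n) a (N ^ r) ⟩
    2 * a * N ^ r * N ^ n      ∎)
    where
    open ≤-Reasoning
    b E Q Σgood Σclashes Σkept : ℕ
    b = length (edges G)
    E = e H
    Q = b * (r ^ suc r * N ^ n)
    Σgood = sumList (edges H) λ f → sumMap λ φ → 𝟙 (does (good? φ f))
    Σclashes = sumList (edges H) λ f → sumMap λ φ → clashes φ f
    Σkept = sumMap λ φ → e (keptSubgraph φ)
    reorder : ∀ b E x → b * E * x ≡ E * (b * x)
    reorder = solve-∀
    reorder′ : ∀ x a y → 2 * (x * a) * y ≡ 2 * a * y * x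
    reorder′ = solve-∀

    Σgood-bound : E * (b * N ^ n) ≤ Σgood * N ^ r
    Σgood-bound = begin
      E * (b * N ^ n)                                                ≡⟨ sym (sumList-const (edges H) _) ⟩
      sumList (edges H) (λ _ → b * N ^ n)                            ≤⟨ sumList-mono-≤ (edges H) (λ {f} f∈H → good-count {f} (All.lookup (uniform H) f∈H)) ⟩
      sumList (edges H) (λ f → sumMap (λ φ → 𝟙 (does (good? φ f))) * N ^ r)  ≡⟨ sumList-distribʳ-* (edges H) _ (N ^ r) ⟩
      Σgood * N ^ r                                                   ∎

    Σclashes-bound : Σclashes * N ^ suc r ≤ E * (r * (D * Q))
    Σclashes-bound = begin
      Σclashes * N ^ suc r                                               ≡⟨ sym (sumList-distribʳ-* (edges H) _ (N ^ suc r)) ⟩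
      sumList (edges H) (λ f → sumMap (λ φ → clashes φ f) * N ^ suc r)  ≤⟨ sumList-mono-≤ (edges H) (λ {f} f∈H → clashes-count {f} (All.lookup (uniform H) f∈H) max-deg r≤N) ⟩
      sumList (edges H) (λ _ → r * (D * Q))                          ≡⟨ sumList-const (edges H) _ ⟩
      E * (r * (D * Q))                                              ∎

    2Σclashes≤Σgood : 2 * Σclashes ≤ Σgood
    2Σclashes≤Σgood = *-cancelʳ-≤ _ _ (N ^ suc r) {{m^n≢0 N (suc r)}} (begin
      2 * Σclashes * N ^ suc r                        ≡⟨ *-assoc 2 Σclashes (N ^ suc r) ⟩
      2 * (Σclashes * N ^ suc r)                      ≤⟨ *-monoʳ-≤ 2 Σclashes-bound ⟩
      2 * (E * (r * (D * Q)))                         ≡⟨ regroup E b r D (r ^ suc r) (N ^ n) ⟩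
      E * (b * N ^ n) * (2 * (r * (D * r ^ suc r)))   ≤⟨ *-monoʳ-≤ (E * (b * N ^ n)) 2rDrʳ⁺¹≤N ⟩
      E * (b * N ^ n) * N                             ≤⟨ *-monoˡ-≤ N Σgood-bound ⟩
      Σgood * N ^ r * N                               ≡⟨ x*y*z≡x*[z*y] Σgood (N ^ r) N ⟩
      Σgood * N ^ suc r                               ∎)
      where
      regroup : ∀ E b r D s t → 2 * (E * (r * (D * (b * (s * t))))) ≡ E * (b * t) * (2 * (r * (D * s)))
      regroup = solve-∀
      x*y*z≡x*[z*y] : ∀ x y z → x * y * z ≡ x * (z * y)
      x*y*z≡x*[z*y] = solve-∀

    Σgood≤Σkept+Σclashes : Σgood ≤ Σkept + Σclashes
    Σgood≤Σkept+Σclashes = begin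
      Σgood                                                                  ≤⟨ sumList-mono-≤ (edges H) (λ {f} _ → sumMap-mono-≤ λ φ → good≤kept+clashes φ f) ⟩
      sumList (edges H) (λ f → sumMap λ φ → 𝟙 (does (kept? φ f)) + clashes φ f)
        ≡⟨ sumList-cong (edges H) (λ f → sumMap-distrib-+ (λ φ → 𝟙 (does (kept? φ f))) (λ φ → clashes φ f)) ⟩
      sumList (edges H) (λ f → sumMap (λ φ → 𝟙 (does (kept? φ f))) + sumMap λ φ → clashes φ f)
        ≡⟨ sumList-distrib-+ (edges H) _ _ ⟩
      sumList (edges H) (λ f → sumMap λ φ → 𝟙 (does (kept? φ f))) + Σclashes    ≡⟨ cong (_+ Σclashes) (sym (sumMap-sumList (edges H) λ f φ → 𝟙 (does (kept? φ f)))) ⟩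
      sumMap (λ φ → sumList (edges H) λ f → 𝟙 (does (kept? φ f))) + Σclashes    ≡⟨ cong (_+ Σclashes) (sumMap-cong λ φ → sym (length-filter≡sumList (kept? φ) (edges H))) ⟩
      Σkept + Σclashes                                                            ∎

    Σkept-bound : Σkept ≤ N ^ n * a
    Σkept-bound with sumMap≤size*some-term (λ φ → e (keptSubgraph φ))
    ... | φ , Σkept≤ = ≤-trans Σkept≤ (*-monoʳ-≤ (N ^ n) (maximal (keptSubgraph φ) (keptSubgraph≤H φ) (keptSubgraph-free 1≤r G-free φ)))

lemma2p1 : (r : ℕ) → 1 ≤ r → (𝓕 : Fam r) →
    Σ ℕ λ k → Σ ℕ λ D₀ →
    (D : ℕ) → D₀ ≤ D →
    (n : ℕ) (H : Graph r n) → MaxDeg≤ H D →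
    (a b : ℕ) → IsExIn H 𝓕 a → IsEx D (ℋ 𝓕) b →
    b * e H ≤ k * a * D ^ r
lemma2p1 r@(suc r') 1≤r 𝓕 = 2 * K ^ r , 1 , bound
  where
  K′ K : ℕ
  K′ = 2 * (r * r ^ suc r)
  K = suc K′
  bound : (D : ℕ) → 1 ≤ D → (n : ℕ) (H : Graph r n) → MaxDeg≤ H D →
          (a b : ℕ) → IsExIn H 𝓕 a → IsEx D (ℋ 𝓕) b → b * e H ≤ 2 * K ^ r * a * D ^ r
  bound D@(suc D') _ n H max-deg a _ ex ((G , G-free , refl) , _) = begin
    e G * e H                ≤⟨ edge-bound 1≤r G-free max-deg r≤KD 2rDrʳ⁺¹≤KD ex ⟩
    2 * a * (K * D) ^ r      ≡⟨ cong (2 * a *_) (^-distribʳ-* K D r) ⟩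
    2 * a * (K ^ r * D ^ r)  ≡⟨ reorder a (K ^ r) (D ^ r) ⟩
    2 * K ^ r * a * D ^ r    ∎
    where
    open ≤-Reasoning
    open Blowup {M = K′ * D} H G using (edge-bound)
    reorder : ∀ a x y → 2 * a * (x * y) ≡ 2 * x * a * y
    reorder = solve-∀
    2rDrʳ⁺¹≤KD : 2 * (r * (D * r ^ suc r)) ≤ K * D
    2rDrʳ⁺¹≤KD = ≤-trans (≤-reflexive (regroup r D (r ^ suc r))) (m≤n+m (K′ * D) D)
      where
      regroup : ∀ r D s → 2 * (r * (D * s)) ≡ 2 * (r * s) * D
      regroup = solve-∀
    r≤KD : r ≤ K * D
    r≤KD = ≤-trans (m≤m*n r (D * r ^ suc r) {{m*n≢0 D (r ^ suc r) {{_}} {{m^n≢0 r (suc r)}}}})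
                   (≤-trans (m≤n*m _ 2) 2rDrʳ⁺¹≤KD)
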